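{- In the $F_3$ Black Hole Zeckendorf game, the position $(a,b)$ is an $N$ position in each of the following cases: (1) $a\equiv b\equiv 1\pmod 3$; (2) $a\equiv b\equiv 2\pmod 3$; (3) $a\equiv 2$ and $b\equiv 1\pmod 3$; (4) $a\equiv 1$ and $b\equiv 2\pmod 3$; (5) $a\equiv 0$ and $b\equiv 2\pmod 3$; (6) $a\equiv 2$ and $b\equiv 0\pmod 3$.
   Context: The $F_3$ Black Hole Zeckendorf game: a position is a pair $(a,b)$ of nonnegative integers, the numbers of pieces in the columns of weight $F_1=1$ and $F_2=2$. Two players alternate moves; the available moves are: (merge) if $a\ge 2$, go to $(a-2,b+1)$; (add) if $a\ge1,b\ge1$, go to $(a-1,b-1)$; (split) if $b\ge 2$, go to $(a+1,b-2)$ (pieces landing in column $F_3$, the "black hole", are removed). The player making the last move wins. A position is a $P$ position if the player to move from it loses under optimal play, and an $N$ position if the player to move can force a win; positions with no move are $P$ positions. -}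

module Defs where

open import Data.Nat using (ℕ; suc; _+_)
open import Data.Product using (_×_; Σ-syntax)

-- A position (a , b): a pieces in column F₁ = 1, b pieces in column F₂ = 2.
Position : Set
Position = ℕ × ℕ

open import Data.Product using (_,_) public

data Move : Position → Position → Set where
  merge : ∀ a b → Move (suc (suc a) , b) (a , suc b)
  add   : ∀ a b → Move (suc a , suc b) (a , b)
  split : ∀ a b → Move (a , suc (suc b)) (suc a , b)

-- P / N positions under normal play (last move wins); the game is finite
-- (a + 2b never increases, and strictly decreases unless a decreases),
-- so the inductive characterisation is the standard one.
data IsP (p : Position) : Set
data IsN (p : Position) : Set

data IsP p where
  allN : (∀ q → Move p q → IsN q) → IsP p

data IsN p where
  toP : (q : Position) → Move p q → IsP q → IsN p

{-# OPTIONS --safe #-}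
module Submission where

-- The P positions are exactly those with (a , b) ≡ (0 , 0), (0 , 1) or (1 , 0) modulo 3.
-- Every move out of one of these three classes lands in one of the six others, and from
-- each of the six others a single move leads back into them.  Writing a position as
-- (r + i * 3 , s + j * 3), the mutual induction runs structurally on i and j; the
-- factor is written i * 3 because suc i * 3 reduces to 3 + i * 3, so moves can be matched.

open import Defs
open import Data.Nat using (ℕ; zero; suc; _+_; _*_; _%_; _/_)
open import Data.Nat.DivMod using (m≡m%n+[m/n]*n)
open import Data.Product using (_×_)
open import Data.Sum using (_⊎_; inj₁; inj₂)
open import Relation.Binary.PropositionalEquality using (_≡_; refl; sym; cong₂; subst)

mutual
  P-0-0 : ∀ i j → IsP (i * 3 , j * 3)
  P-0-0 i j = allN (P-0-0-moves i j)

  P-0-0-moves : ∀ i j q → Move (i * 3 , j * 3) q → IsN q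
  P-0-0-moves zero    (suc j) _ (split _ _) = N-1-1 zero j
  P-0-0-moves (suc i) zero    _ (merge _ _) = N-1-1 i zero
  P-0-0-moves (suc i) (suc j) _ (merge _ _) = N-1-1 i (suc j)
  P-0-0-moves (suc i) (suc j) _ (add _ _)   = N-2-2 i j
  P-0-0-moves (suc i) (suc j) _ (split _ _) = N-1-1 (suc i) j

  P-0-1 : ∀ i j → IsP (i * 3 , 1 + j * 3)
  P-0-1 i j = allN (P-0-1-moves i j)

  P-0-1-moves : ∀ i j q → Move (i * 3 , 1 + j * 3) q → IsN q
  P-0-1-moves zero    (suc j) _ (split _ _) = N-1-2 zero j
  P-0-1-moves (suc i) zero    _ (merge _ _) = N-1-2 i zero
  P-0-1-moves (suc i) zero    _ (add _ _)   = N-2-0 i zero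
  P-0-1-moves (suc i) (suc j) _ (merge _ _) = N-1-2 i (suc j)
  P-0-1-moves (suc i) (suc j) _ (add _ _)   = N-2-0 i (suc j)
  P-0-1-moves (suc i) (suc j) _ (split _ _) = N-1-2 (suc i) j

  P-1-0 : ∀ i j → IsP (1 + i * 3 , j * 3)
  P-1-0 i j = allN (P-1-0-moves i j)

  P-1-0-moves : ∀ i j q → Move (1 + i * 3 , j * 3) q → IsN q
  P-1-0-moves zero    (suc j) _ (add _ _)   = N-0-2 zero j
  P-1-0-moves zero    (suc j) _ (split _ _) = N-2-1 zero j
  P-1-0-moves (suc i) zero    _ (merge _ _) = N-2-1 i zero
  P-1-0-moves (suc i) (suc j) _ (merge _ _) = N-2-1 i (suc j)
  P-1-0-moves (suc i) (suc j) _ (add _ _)   = N-0-2 (suc i) j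
  P-1-0-moves (suc i) (suc j) _ (split _ _) = N-2-1 (suc i) j

  N-1-1 : ∀ i j → IsN (1 + i * 3 , 1 + j * 3)
  N-1-1 i j = toP _ (add _ _) (P-0-0 i j)

  N-2-2 : ∀ i j → IsN (2 + i * 3 , 2 + j * 3)
  N-2-2 i j = toP _ (merge _ _) (P-0-0 i (suc j))

  N-1-2 : ∀ i j → IsN (1 + i * 3 , 2 + j * 3)
  N-1-2 i j = toP _ (add _ _) (P-0-1 i j)

  N-2-0 : ∀ i j → IsN (2 + i * 3 , j * 3)
  N-2-0 i j = toP _ (merge _ _) (P-0-1 i j)

  N-2-1 : ∀ i j → IsN (2 + i * 3 , 1 + j * 3)
  N-2-1 i j = toP _ (add _ _) (P-1-0 i j)

  N-0-2 : ∀ i j → IsN (i * 3 , 2 + j * 3)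
  N-0-2 i j = toP _ (split _ _) (P-1-0 i j)

IsN-byResidues : ∀ {a b r s} → a % 3 ≡ r → b % 3 ≡ s →
                 (∀ i j → IsN (r + i * 3 , s + j * 3)) → IsN (a , b)
IsN-byResidues {a} {b} refl refl N-r-s =
  subst IsN (sym (cong₂ _,_ (m≡m%n+[m/n]*n a 3) (m≡m%n+[m/n]*n b 3))) (N-r-s (a / 3) (b / 3))

theorem4p6 : (a b : ℕ) →
    ((a % 3 ≡ 1 × b % 3 ≡ 1)
     ⊎ (a % 3 ≡ 2 × b % 3 ≡ 2)
     ⊎ (a % 3 ≡ 2 × b % 3 ≡ 1)
     ⊎ (a % 3 ≡ 1 × b % 3 ≡ 2)
     ⊎ (a % 3 ≡ 0 × b % 3 ≡ 2)
     ⊎ (a % 3 ≡ 2 × b % 3 ≡ 0)) →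
    IsN (a , b)
theorem4p6 a b (inj₁ (a≡1 , b≡1))                               = IsN-byResidues a≡1 b≡1 N-1-1
theorem4p6 a b (inj₂ (inj₁ (a≡2 , b≡2)))                        = IsN-byResidues a≡2 b≡2 N-2-2
theorem4p6 a b (inj₂ (inj₂ (inj₁ (a≡2 , b≡1))))                 = IsN-byResidues a≡2 b≡1 N-2-1
theorem4p6 a b (inj₂ (inj₂ (inj₂ (inj₁ (a≡1 , b≡2)))))          = IsN-byResidues a≡1 b≡2 N-1-2
theorem4p6 a b (inj₂ (inj₂ (inj₂ (inj₂ (inj₁ (a≡0 , b≡2))))))   = IsN-byResidues a≡0 b≡2 N-0-2
theorem4p6 a b (inj₂ (inj₂ (inj₂ (inj₂ (inj₂ (a≡2 , b≡0))))))   = IsN-byResidues a≡2 b≡0 N-2-0
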